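{- Let $R = R_1 \times \cdots \times R_t$ be a finite commutative ring with nonzero identity, where each $R_i$ is a (finite commutative) local ring. Then the involutory Cayley graph $\Gamma(R)$ is connected if and only if at most one of the graphs $\Gamma(R_i)$ is a connected graph of even size (i.e. with an even number of vertices, $|R_i|$ even) and each remaining $R_i$ is isomorphic to $\mathbb{Z}_{p_i^{n_i}}$ for some odd prime number $p_i$ and positive integer $n_i$.
   Context: All rings are finite, commutative, with a nonzero identity. An element $u$ of a ring $R$ is an involution if $u^2=1$; $\mathrm{inv}(R)$ denotes the set of involutions. The involutory Cayley graph $\Gamma(R)$ is the simple undirected graph with vertex set $R$ in which distinct $x,y$ are adjacent if and only if $(x-y)^2 = 1$ (i.e. the Cayley graph of $(R,+)$ with respect to $\mathrm{inv}(R)$). -}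

module Defs where

open import Level using (Level; _⊔_; 0ℓ)
open import Data.Nat as ℕ using (ℕ; _^_; _≤_)
open import Data.Nat.Divisibility as ℕD using ()
open import Data.Nat.Primality using (Prime)
open import Data.Integer as ℤ using (ℤ; +_)
open import Data.Integer.Divisibility as ℤD using ()
open import Data.Fin using (Fin)
open import Data.Product using (Σ; ∃; ∃-syntax; _×_)
open import Data.Sum using (_⊎_)
open import Relation.Nullary using (¬_)
open import Relation.Unary using (Pred; _∈_; _⊆_)
open import Relation.Binary.PropositionalEquality as ≡ using (_≡_; _≢_)
open import Relation.Binary.Construct.Closure.ReflexiveTransitive using (Star)
open import Function.Bundles using (Inverse)
open import Algebra.Bundles using (CommutativeRing)
open import Algebra.Bundles.Raw using (RawRing)
open import Algebra.Morphism.Structures using (module RingMorphisms)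

private
  variable
    c ℓ : Level

module _ (R : RawRing c ℓ) where
  open RawRing R

  Adjacent : Carrier → Carrier → Set ℓ
  Adjacent x y = ¬ (x ≈ y) × ((x + - y) * (x + - y) ≈ 1#)

  -- one step of a walk: move along an edge, or stay at the same vertex
  -- (elements equal under _≈_ are the same vertex)
  Step : Carrier → Carrier → Set ℓ
  Step x y = Adjacent x y ⊎ x ≈ y

  Reachable : Carrier → Carrier → Set (c ⊔ ℓ)
  Reachable = Star Step

  ΓConnected : Set (c ⊔ ℓ)
  ΓConnected = ∀ x y → Reachable x y

ΓConnectedRing : CommutativeRing c ℓ → Set (c ⊔ ℓ)
ΓConnectedRing R = ΓConnected (CommutativeRing.rawRing R)

ΠRing : (t : ℕ) → (Fin t → CommutativeRing c ℓ) → RawRing c ℓ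
ΠRing t Rs = record
  { Carrier = (i : Fin t) → CommutativeRing.Carrier (Rs i)
  ; _≈_ = λ x y → ∀ i → CommutativeRing._≈_ (Rs i) (x i) (y i)
  ; _+_ = λ x y i → CommutativeRing._+_ (Rs i) (x i) (y i)
  ; _*_ = λ x y i → CommutativeRing._*_ (Rs i) (x i) (y i)
  ; -_  = λ x i → CommutativeRing.-_ (Rs i) (x i)
  ; 0#  = λ i → CommutativeRing.0# (Rs i)
  ; 1#  = λ i → CommutativeRing.1# (Rs i)
  }

HasSize : CommutativeRing c ℓ → ℕ → Set (c ⊔ ℓ)
HasSize R n = Inverse (≡.setoid (Fin n)) (CommutativeRing.setoid R)

IsFinite : CommutativeRing c ℓ → Set (c ⊔ ℓ)
IsFinite R = ∃[ n ] HasSize R n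

EvenSize : CommutativeRing c ℓ → Set (c ⊔ ℓ)
EvenSize R = ∃[ n ] (HasSize R n × 2 ℕD.∣ n)

module _ (R : CommutativeRing c ℓ) where
  open CommutativeRing R

  record IsIdeal (I : Pred Carrier (c ⊔ ℓ)) : Set (c ⊔ ℓ) where
    field
      resp  : ∀ {x y} → x ≈ y → x ∈ I → y ∈ I
      zero∈ : 0# ∈ I
      +-closed : ∀ {x y} → x ∈ I → y ∈ I → (x + y) ∈ I
      *-closed : ∀ r {x} → x ∈ I → (r * x) ∈ I

  record IsMaximalIdeal (M : Pred Carrier (c ⊔ ℓ)) : Set (Level.suc (c ⊔ ℓ)) where
    field
      isIdeal : IsIdeal M
      proper  : ¬ (1# ∈ M)
      maximal : ∀ (J : Pred Carrier (c ⊔ ℓ)) → IsIdeal J → M ⊆ J →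
                (J ⊆ M) ⊎ (1# ∈ J)

  IsLocal : Set (Level.suc (c ⊔ ℓ))
  IsLocal = Σ (Pred Carrier (c ⊔ ℓ)) λ M → IsMaximalIdeal M ×
              (∀ N → IsMaximalIdeal N → (N ⊆ M) × (M ⊆ N))

-- The ring ℤ_m = ℤ / mℤ, as ℤ with equality "congruent modulo m"

ℤmod : ℕ → RawRing 0ℓ 0ℓ
ℤmod m = record
  { Carrier = ℤ
  ; _≈_ = λ x y → (+ m) ℤD.∣ (x ℤ.- y)
  ; _+_ = ℤ._+_
  ; _*_ = ℤ._*_
  ; -_  = ℤ.-_
  ; 0#  = ℤ.0ℤ
  ; 1#  = ℤ.1ℤ
  }

_≅ʳ_ : RawRing c ℓ → RawRing 0ℓ 0ℓ → Set (c ⊔ ℓ)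
A ≅ʳ B = Σ (RawRing.Carrier A → RawRing.Carrier B) λ f →
           RingMorphisms.IsRingIsomorphism A B f

IsZOddPrimePower : CommutativeRing c ℓ → Set (c ⊔ ℓ)
IsZOddPrimePower R = ∃[ p ] ∃[ n ]
  (Prime p × ¬ (2 ℕD.∣ p) × 1 ≤ n × (CommutativeRing.rawRing R ≅ʳ ℤmod (p ^ n)))

{-# OPTIONS --safe #-}
-- Γ(R) is the Cayley graph of (R, +) for the involutions, so the component of 0 is the additive
-- subgroup generated by inv(R); walks in Γ(R₁ × ⋯ × Rₜ) project to walks in each Γ(Rᵢ).
-- In a finite local ring with maximal ideal M (whose maximality also yields excluded middle)
-- every involution u has (u - 1)(u + 1) = 0.  If 2 ∉ M this forces u = ±1, so when Γ(R) is
-- connected every element is an integer, R ≅ ℤ/char, and locality makes char a prime power, odd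
-- since 2 is a unit.  If 2 ∈ M every involution is 1 modulo M, so each step swaps the cosets M
-- and 1 + M; two such factors move in lockstep, which separates 0 from (1, 0, …, 0).  Moreover
-- char is then even, and translation by char/2 pairs off the elements, so |R| is even.
-- Conversely, δᵢ 2 is the difference of the involutions 1 and 1[i ↦ -1], and 2 is a unit in
-- ℤ/pⁿ for odd p, so every δᵢ a is reachable for an odd factor; walks in a remaining connected
-- factor lift coordinatewise, and every vector is the sum of its δᵢ.
module Submission where

open import Defs
open import Level using (Level)
open import Data.Nat using (ℕ; _≤_)
open import Data.Fin using (Fin)
open import Data.Product using (∃-syntax; _×_)
open import Data.Sum using (_⊎_)
open import Relation.Binary.PropositionalEquality using (_≢_)
open import Function.Bundles using (_⇔_)
open import Algebra.Bundles using (CommutativeRing)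

open import Level using (_⊔_; Lift; lift; 0ℓ)
open import Data.Nat as ℕ using (zero; suc; NonZero; z≤n; s≤s)
import Data.Nat.Properties as ℕ
open import Data.Nat.Divisibility as ℕ using (divides; _∣?_)
open import Data.Nat.DivMod using (_%_; _/_; m≡m%n+[m/n]*n; m%n<n)
open import Data.Nat.Primality using (Prime; prime[2]; ¬prime[1]; euclidsLemma; prime⇒irreducible; prime⇒nonTrivial)
open import Data.Nat.Primality.Factorisation using (factorise)
open import Data.Nat.Coprimality using (Coprime; coprime-Bézout)
open import Data.Nat.GCD using (module Bézout)
open import Data.Nat.ListAction using (product)
import Data.Nat.Tactic.RingSolver as ℕ-Tactic
open import Data.Integer as ℤ using (ℤ; +_; -[1+_]; _⊖_; _◃_; sign; ∣_∣)
import Data.Integer.Properties as ℤ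
import Data.Integer.Divisibility as ℤ
import Data.Integer.Divisibility.Signed as ℤˢ
open import Data.Sign as Sign using (Sign)
open import Data.Fin as Fin using (_<?_; toℕ)
import Data.Fin.Properties as Fin
open import Data.Fin.Permutation using (permutation)
open import Data.List using ([]; _∷_; length)
open import Data.List.Relation.Unary.All using (All; []; _∷_)
open import Data.Vec.Functional using (Vector; head; tail)
open import Data.Bool using (if_then_else_)
import Data.Maybe as Maybe
open import Data.Product using (∃₂; _,_; proj₁; proj₂)
open import Data.Sum using (inj₁; inj₂; [_,_])
open import Data.Empty using (⊥)
open import Relation.Nullary using (¬_; yes; no; contradiction)
open import Relation.Nullary.Decidable using (does; dec-true; dec-false; dec⇒maybe; decidable-stable)
open import Relation.Unary as U using (Pred; _∈_; _∉_; _⊆_)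
open import Relation.Binary.Bundles using (Setoid)
open import Relation.Binary.Definitions using (Decidable; _Respects_; tri<; tri≈; tri>)
open import Relation.Binary.PropositionalEquality as ≡ using (_≡_)
open import Relation.Binary.Construct.Closure.ReflexiveTransitive using (ε; _◅_; _◅◅_; gmap)
open import Axiom.ExcludedMiddle using (ExcludedMiddle)
open import Axiom.DoubleNegationElimination using (em⇒dne)
open import Function using (_∘_; id; flip)
open import Function.Bundles using (Inverse; Injection; mk⇔)
open import Function.Properties.Inverse using (Inverse⇒Injection)
import Function.Construct.Symmetry as Symmetry
open import Algebra.Bundles using (Monoid)
open import Algebra.Bundles.Raw using (RawRing)
open import Algebra.Morphism.Structures using (module RingMorphisms)
import Algebra.Solver.Ring
import Algebra.Solver.Ring.AlmostCommutativeRing as AlmostCommutativeRing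
import Algebra.Properties.Ring
import Algebra.Properties.CommutativeSemigroup
import Algebra.Properties.Semiring.Mult.TCOptimised
import Algebra.Properties.CommutativeMonoid.Sum
import Algebra.Properties.Monoid.Sum
import Relation.Binary.Reasoning.Setoid

private
  variable
    c ℓ : Level

module _ {p} {P : Pred ℕ p} (P? : U.Decidable P) where

  leastWitness : ∀ {n} → P n → ∃[ m ] P m × (∀ {k} → k ℕ.< m → ¬ P k)
  leastWitness {n} Pn = leastWitnessBelow (suc n) (n , ℕ.n<1+n n , Pn)
    where
    leastWitnessBelow : ∀ b → ∃[ k ] k ℕ.< b × P k → ∃[ m ] P m × (∀ {k} → k ℕ.< m → ¬ P k)
    leastWitnessBelow (suc b) (k , k<1+b , Pk) with ℕ.anyUpTo? P? b
    ... | yes witness = leastWitnessBelow b witness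
    ... | no  none    = k , Pk , λ j<k Pj → none (_ , ℕ.<-≤-trans j<k (ℕ.≤-pred k<1+b) , Pj)

odd⇒≡1+[m/2]*2 : ∀ m → ¬ 2 ℕ.∣ m → m ≡ suc (m / 2 ℕ.* 2)
odd⇒≡1+[m/2]*2 m 2∤m with m % 2 in m%2≡r | m%n<n m 2
... | 0           | _ = contradiction (ℕ.m%n≡0⇒n∣m m 2 m%2≡r) 2∤m
... | 1           | _ = ≡.trans (m≡m%n+[m/n]*n m 2) (≡.cong (ℕ._+ m / 2 ℕ.* 2) m%2≡r)
... | suc (suc _) | s≤s (s≤s ())

¬2∣⇒¬2∣^ : ∀ {p} → ¬ 2 ℕ.∣ p → ∀ k → ¬ 2 ℕ.∣ p ℕ.^ k
¬2∣⇒¬2∣^ 2∤p zero    2∣1   = contradiction (ℕ.∣1⇒≡1 2∣1) λ ()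
¬2∣⇒¬2∣^ 2∤p (suc k) 2∣p^k = [ 2∤p , ¬2∣⇒¬2∣^ 2∤p k ] (euclidsLemma _ _ prime[2] 2∣p^k)

distinctPrimes⇒coprime : ∀ {p q} → Prime p → Prime q → p ≢ q → Coprime p q
distinctPrimes⇒coprime p-prime q-prime p≢q (d∣p , d∣q) with prime⇒irreducible p-prime d∣p
... | inj₁ d≡1   = d≡1
... | inj₂ ≡.refl with prime⇒irreducible q-prime d∣q
...   | inj₁ ≡.refl = contradiction p-prime ¬prime[1]
...   | inj₂ p≡q  = contradiction p≡q p≢q

x+x≡x*2 : ∀ x → x ℕ.+ x ≡ x ℕ.* 2
x+x≡x*2 = ℕ-Tactic.solve-∀

product≡^length : ∀ {p} qs → All (_≡ p) qs → product qs ≡ p ℕ.^ length qs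
product≡^length []       []           = ≡.refl
product≡^length (q ∷ qs) (≡.refl ∷ qs≡) = ≡.cong (q ℕ.*_) (product≡^length qs qs≡)

module _ where
  open Algebra.Properties.CommutativeMonoid.Sum ℕ.+-0-commutativeMonoid
    using (sum; sum-permute; ∑-distrib-+; sum-cong-≗)

  [_<_] : ∀ {n} → Fin n → Fin n → ℕ
  [ i < j ] = if does (i <? j) then 1 else 0

  [<]+[>]≡1 : ∀ {n} {i j : Fin n} → i ≢ j → [ i < j ] ℕ.+ [ j < i ] ≡ 1
  [<]+[>]≡1 {i = i} {j} i≢j with Fin.<-cmp i j
  ... | tri< i<j _ j≮i rewrite dec-true (i <? j) i<j | dec-false (j <? i) j≮i = ≡.refl
  ... | tri≈ _ i≡j _   = contradiction i≡j i≢j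
  ... | tri> i≮j _ j<i rewrite dec-false (i <? j) i≮j | dec-true (j <? i) j<i = ≡.refl

  sum-const-1 : ∀ n → sum {n} (λ _ → 1) ≡ n
  sum-const-1 zero    = ≡.refl
  sum-const-1 (suc n) = ≡.cong suc (sum-const-1 n)

  -- Each orbit {k, τ k} contributes exactly one ascent k < τ k.
  fixedPointFreeInvolution⇒2∣n : ∀ {n} (τ : Fin n → Fin n) →
    (∀ k → τ (τ k) ≡ k) → (∀ k → τ k ≢ k) → 2 ℕ.∣ n
  fixedPointFreeInvolution⇒2∣n {n} τ τ∘τ≡id τk≢k = divides (sum ascent) (begin
    n                                    ≡⟨ sum-const-1 n ⟨
    sum {n} (λ _ → 1)                    ≡⟨ sum-cong-≗ {n} ascent-or-descent ⟨
    sum (λ k → ascent k ℕ.+ ascent (τ k)) ≡⟨ ∑-distrib-+ ascent (ascent ∘ τ) ⟩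
    sum ascent ℕ.+ sum (ascent ∘ τ)      ≡⟨ ≡.cong (sum ascent ℕ.+_) (sum-permute ascent τ-permutation) ⟨
    sum ascent ℕ.+ sum ascent            ≡⟨ x+x≡x*2 (sum ascent) ⟩
    sum ascent ℕ.* 2                     ∎)
    where
    open ≡.≡-Reasoning
    τ-permutation = permutation τ τ τ∘τ≡id τ∘τ≡id
    ascent : Fin n → ℕ
    ascent k = [ k < τ k ]
    ascent-or-descent : ∀ k → ascent k ℕ.+ ascent (τ k) ≡ 1
    ascent-or-descent k rewrite τ∘τ≡id k = [<]+[>]≡1 (τk≢k k ∘ ≡.sym)

module _ {a ℓ} (M : Monoid a ℓ) where
  open Monoid M renaming (_∙_ to _+_; ε to 0#; identityˡ to +-identityˡ; identityʳ to +-identityʳ)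
  open Algebra.Properties.Monoid.Sum M using (sum; sum-cong-≋; sum-replicate-zero)

  sum-supported : ∀ {n} (f : Vector Carrier n) k → (∀ l → l ≢ k → f l ≈ 0#) → sum f ≈ f k
  sum-supported {suc n} f Fin.zero    f≈0 = trans (∙-congˡ tail≈0) (+-identityʳ _)
    where tail≈0 = trans (sum-cong-≋ (λ l → f≈0 (Fin.suc l) λ ())) (sum-replicate-zero n)
  sum-supported {suc n} f (Fin.suc k) f≈0 = trans (∙-cong (f≈0 Fin.zero λ ()) tail≈fk) (+-identityˡ _)
    where tail≈fk = sum-supported (tail f) k (λ l l≢k → f≈0 (Fin.suc l) (l≢k ∘ Fin.suc-injective))

-- Its rawRing is definitionally ΠRing t Rs.
ΠCommutativeRing : (t : ℕ) → (Fin t → CommutativeRing c ℓ) → CommutativeRing c ℓ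
ΠCommutativeRing t Rs = record
  { Carrier = ∀ i → R.Carrier i
  ; _≈_     = λ x y → ∀ i → R._≈_ i (x i) (y i)
  ; _+_     = λ x y i → R._+_ i (x i) (y i)
  ; _*_     = λ x y i → R._*_ i (x i) (y i)
  ; -_      = λ x i → R.-_ i (x i)
  ; 0#      = λ i → R.0# i
  ; 1#      = λ i → R.1# i
  ; isCommutativeRing = record
    { isRing = record
      { +-isAbelianGroup = record
        { isGroup = record
          { isMonoid = record
            { isSemigroup = record
              { isMagma = record
                { isEquivalence = record
                  { refl  = λ i → R.refl i
                  ; sym   = λ x≈y i → R.sym i (x≈y i)
                  ; trans = λ x≈y y≈z i → R.trans i (x≈y i) (y≈z i)
                  }
                ; ∙-cong = λ x≈y u≈v i → R.+-cong i (x≈y i) (u≈v i)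
                }
              ; assoc = λ x y z i → R.+-assoc i (x i) (y i) (z i)
              }
            ; identity = (λ x i → R.+-identityˡ i (x i)) , (λ x i → R.+-identityʳ i (x i))
            }
          ; inverse = (λ x i → R.-‿inverseˡ i (x i)) , (λ x i → R.-‿inverseʳ i (x i))
          ; ⁻¹-cong = λ x≈y i → R.-‿cong i (x≈y i)
          }
        ; comm = λ x y i → R.+-comm i (x i) (y i)
        }
      ; *-cong     = λ x≈y u≈v i → R.*-cong i (x≈y i) (u≈v i)
      ; *-assoc    = λ x y z i → R.*-assoc i (x i) (y i) (z i)
      ; *-identity = (λ x i → R.*-identityˡ i (x i)) , (λ x i → R.*-identityʳ i (x i))
      ; distrib    = (λ x y z i → R.distribˡ i (x i) (y i) (z i)) , (λ x y z i → R.distribʳ i (x i) (y i) (z i))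
      }
    ; *-comm = λ x y i → R.*-comm i (x i) (y i)
    }
  }
  where module R (i : Fin t) = CommutativeRing (Rs i)

module _ (R : CommutativeRing c ℓ) where
  open CommutativeRing R

  Unit : Pred Carrier (c ⊔ ℓ)
  Unit x = ∃[ y ] x * y ≈ 1#

  Involution : Pred Carrier ℓ
  Involution u = u * u ≈ 1#

module IntegerMultiples (R : CommutativeRing c ℓ) where
  open CommutativeRing R
  open Algebra.Properties.Ring ring using (-0#≈0#; -‿+-comm; -‿involutive; -1*x≈-x)
  open Algebra.Properties.CommutativeSemigroup +-commutativeSemigroup using () renaming (interchange to +-interchange)
  open Algebra.Properties.CommutativeSemigroup *-commutativeSemigroup using () renaming (interchange to *-interchange)
  open Algebra.Properties.Semiring.Mult.TCOptimised semiring using (1+×; ×-homo-+; ×1-homo-*)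
    renaming (_×_ to _×′_)
  open Relation.Binary.Reasoning.Setoid setoid

  fromℕ : ℕ → Carrier
  fromℕ n = n ×′ 1#

  fromℕ-suc : ∀ n → fromℕ (suc n) ≈ 1# + fromℕ n
  fromℕ-suc n = 1+× n 1#

  fromℕ-homo-+ : ∀ m n → fromℕ (m ℕ.+ n) ≈ fromℕ m + fromℕ n
  fromℕ-homo-+ = ×-homo-+ 1#

  fromℕ-homo-* : ∀ m n → fromℕ (m ℕ.* n) ≈ fromℕ m * fromℕ n
  fromℕ-homo-* = ×1-homo-*

  fromℤ : ℤ → Carrier
  fromℤ (+ n)    = fromℕ n
  fromℤ -[1+ n ] = - fromℕ (suc n)

  fromℤ-homo-⊖ : ∀ m n → fromℤ (m ⊖ n) ≈ fromℕ m - fromℕ n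
  fromℤ-homo-⊖ m       zero    = sym (trans (+-congˡ -0#≈0#) (+-identityʳ _))
  fromℤ-homo-⊖ zero    (suc n) = sym (+-identityˡ _)
  fromℤ-homo-⊖ (suc m) (suc n) = begin
    fromℤ (suc m ⊖ suc n)              ≡⟨ ≡.cong fromℤ (ℤ.[1+m]⊖[1+n]≡m⊖n m n) ⟩
    fromℤ (m ⊖ n)                      ≈⟨ fromℤ-homo-⊖ m n ⟩
    fromℕ m - fromℕ n                  ≈⟨ +-identityˡ _ ⟨
    0# + (fromℕ m - fromℕ n)           ≈⟨ +-congʳ (-‿inverseʳ 1#) ⟨
    (1# - 1#) + (fromℕ m - fromℕ n)    ≈⟨ +-interchange _ _ _ _ ⟩
    (1# + fromℕ m) + (- 1# - fromℕ n)  ≈⟨ +-congˡ (-‿+-comm 1# (fromℕ n)) ⟩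
    (1# + fromℕ m) - (1# + fromℕ n)    ≈⟨ +-cong (fromℕ-suc m) (-‿cong (fromℕ-suc n)) ⟨
    fromℕ (suc m) - fromℕ (suc n)      ∎

  fromℤ-homo-+ : ∀ i j → fromℤ (i ℤ.+ j) ≈ fromℤ i + fromℤ j
  fromℤ-homo-+ (+ m)    (+ n)    = fromℕ-homo-+ m n
  fromℤ-homo-+ (+ m)    -[1+ n ] = fromℤ-homo-⊖ m (suc n)
  fromℤ-homo-+ -[1+ m ] (+ n)    = trans (fromℤ-homo-⊖ n (suc m)) (+-comm _ _)
  fromℤ-homo-+ -[1+ m ] -[1+ n ] = begin
    - fromℕ (suc (suc (m ℕ.+ n)))      ≡⟨ ≡.cong (λ k → - fromℕ (suc k)) (ℕ.+-suc m n) ⟨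
    - fromℕ (suc m ℕ.+ suc n)          ≈⟨ -‿cong (fromℕ-homo-+ (suc m) (suc n)) ⟩
    - (fromℕ (suc m) + fromℕ (suc n))  ≈⟨ -‿+-comm _ _ ⟨
    - fromℕ (suc m) - fromℕ (suc n)    ∎

  fromℤ-homo-‿ : ∀ i → fromℤ (ℤ.- i) ≈ - fromℤ i
  fromℤ-homo-‿ (+ zero)  = sym -0#≈0#
  fromℤ-homo-‿ (+ suc n) = refl
  fromℤ-homo-‿ -[1+ n ]  = sym (-‿involutive _)

  fromℤ-homo-sub : ∀ i j → fromℤ (i ℤ.- j) ≈ fromℤ i - fromℤ j
  fromℤ-homo-sub i j = trans (fromℤ-homo-+ i (ℤ.- j)) (+-congˡ (fromℤ-homo-‿ j))

  fromSign : Sign → Carrier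
  fromSign Sign.+ = 1#
  fromSign Sign.- = - 1#

  fromSign-homo-* : ∀ s t → fromSign (s Sign.* t) ≈ fromSign s * fromSign t
  fromSign-homo-* Sign.+ t      = sym (*-identityˡ _)
  fromSign-homo-* Sign.- Sign.+ = sym (*-identityʳ _)
  fromSign-homo-* Sign.- Sign.- = sym (trans (-1*x≈-x (- 1#)) (-‿involutive 1#))

  fromℤ-◃ : ∀ s n → fromℤ (s ◃ n) ≈ fromSign s * fromℕ n
  fromℤ-◃ s      zero    = sym (zeroʳ _)
  fromℤ-◃ Sign.+ (suc n) = sym (*-identityˡ _)
  fromℤ-◃ Sign.- (suc n) = sym (-1*x≈-x _)

  fromℤ≈sign*abs : ∀ i → fromℤ i ≈ fromSign (sign i) * fromℕ ∣ i ∣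
  fromℤ≈sign*abs i = trans (reflexive (≡.cong fromℤ (≡.sym (ℤ.◃-inverse i)))) (fromℤ-◃ (sign i) ∣ i ∣)

  fromℤ-homo-* : ∀ i j → fromℤ (i ℤ.* j) ≈ fromℤ i * fromℤ j
  fromℤ-homo-* i j = begin
    fromℤ (s ◃ ∣ i ∣ ℕ.* ∣ j ∣)                      ≈⟨ fromℤ-◃ s (∣ i ∣ ℕ.* ∣ j ∣) ⟩
    fromSign s * fromℕ (∣ i ∣ ℕ.* ∣ j ∣)            ≈⟨ *-cong (fromSign-homo-* (sign i) (sign j)) (fromℕ-homo-* ∣ i ∣ ∣ j ∣) ⟩
    (σᵢ * σⱼ) * (fromℕ ∣ i ∣ * fromℕ ∣ j ∣)         ≈⟨ *-interchange _ _ _ _ ⟩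
    (σᵢ * fromℕ ∣ i ∣) * (σⱼ * fromℕ ∣ j ∣)         ≈⟨ *-cong (fromℤ≈sign*abs i) (fromℤ≈sign*abs j) ⟨
    fromℤ i * fromℤ j                               ∎
    where
    s  = sign i Sign.* sign j
    σᵢ = fromSign (sign i)
    σⱼ = fromSign (sign j)

  fromℤ-morphism : ℤ.+-*-rawRing AlmostCommutativeRing.-Raw-AlmostCommutative⟶ AlmostCommutativeRing.fromCommutativeRing R
  fromℤ-morphism = record
    { ⟦_⟧    = fromℤ
    ; +-homo = fromℤ-homo-+
    ; *-homo = fromℤ-homo-*
    ; -‿homo = fromℤ-homo-‿
    ; 0-homo = refl
    ; 1-homo = refl
    }

  module Solver = Algebra.Solver.Ring ℤ.+-*-rawRing (AlmostCommutativeRing.fromCommutativeRing R) fromℤ-morphism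
    (λ i j → Maybe.map (reflexive ∘ ≡.cong fromℤ) (dec⇒maybe (i ℤ.≟ j)))

  odd⇒2-unit : ∀ {m} → ¬ 2 ℕ.∣ m → fromℕ m ≈ 0# → Unit R (fromℕ 2)
  odd⇒2-unit {m} 2∤m m≈0 = fromℕ (suc (m / 2)) , (begin
    fromℕ 2 * fromℕ (suc (m / 2))      ≈⟨ *-comm _ _ ⟩
    fromℕ (suc (m / 2)) * fromℕ 2      ≈⟨ fromℕ-homo-* (suc (m / 2)) 2 ⟨
    fromℕ (suc (suc (m / 2 ℕ.* 2)))    ≡⟨ ≡.cong (fromℕ ∘ suc) (odd⇒≡1+[m/2]*2 m 2∤m) ⟨
    fromℕ (suc m)                      ≈⟨ fromℕ-suc m ⟩
    1# + fromℕ m                       ≈⟨ +-congˡ m≈0 ⟩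
    1# + 0#                            ≈⟨ +-identityʳ 1# ⟩
    1#                                 ∎)

record IsAdditiveSubgroup (R : CommutativeRing c ℓ) {p} (S : Pred (CommutativeRing.Carrier R) p) : Set (c ⊔ ℓ ⊔ p) where
  open CommutativeRing R
  field
    ∈-resp   : S Respects _≈_
    0∈       : 0# ∈ S
    +-closed : ∀ {x y} → x ∈ S → y ∈ S → x + y ∈ S
    -‿closed : ∀ {x} → x ∈ S → - x ∈ S

  open IntegerMultiples R using (fromℕ; fromℤ; fromℕ-suc)
  open Algebra.Properties.Ring ring using (-‿distribˡ-*)
  open Algebra.Properties.CommutativeMonoid.Sum +-commutativeMonoid using (sum)

  difference-closed : ∀ {x y} → x ∈ S → y ∈ S → x - y ∈ S
  difference-closed x∈S y∈S = +-closed x∈S (-‿closed y∈S)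

  fromℕ*-closed : ∀ {x} → x ∈ S → ∀ n → fromℕ n * x ∈ S
  fromℕ*-closed x∈S zero    = ∈-resp (sym (zeroˡ _)) 0∈
  fromℕ*-closed x∈S (suc n) = ∈-resp (sym [1+n]x≈x+nx) (+-closed x∈S (fromℕ*-closed x∈S n))
    where [1+n]x≈x+nx = trans (*-congʳ (fromℕ-suc n)) (trans (distribʳ _ _ _) (+-congʳ (*-identityˡ _)))

  fromℤ*-closed : ∀ {x} → x ∈ S → ∀ z → fromℤ z * x ∈ S
  fromℤ*-closed x∈S (+ n)    = fromℕ*-closed x∈S n
  fromℤ*-closed x∈S -[1+ n ] = ∈-resp (-‿distribˡ-* _ _) (-‿closed (fromℕ*-closed x∈S (suc n)))

  ∑-closed : ∀ {n} {f : Vector Carrier n} → (∀ i → f i ∈ S) → sum f ∈ S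
  ∑-closed {zero}  f∈S = 0∈
  ∑-closed {suc n} f∈S = +-closed (f∈S Fin.zero) (∑-closed (f∈S ∘ Fin.suc))

module _ (R : CommutativeRing c ℓ) where
  open CommutativeRing R
  open IntegerMultiples R using (fromℤ; fromℤ-homo-+; fromℤ-homo-‿)

  Integral : Pred Carrier ℓ
  Integral x = ∃[ z ] x ≈ fromℤ z

  Integral-isAdditiveSubgroup : IsAdditiveSubgroup R Integral
  Integral-isAdditiveSubgroup = record
    { ∈-resp   = λ { x≈y (z , x≈z) → z , trans (sym x≈y) x≈z }
    ; 0∈       = + 0 , refl
    ; +-closed = λ { (a , x≈a) (b , y≈b) → a ℤ.+ b , trans (+-cong x≈a y≈b) (sym (fromℤ-homo-+ a b)) }
    ; -‿closed = λ { (a , x≈a) → ℤ.- a , trans (-‿cong x≈a) (sym (fromℤ-homo-‿ a)) }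
    }

module InvolutoryCayleyGraph (R : CommutativeRing c ℓ) (_≟_ : Decidable (CommutativeRing._≈_ R)) where
  open CommutativeRing R
  open Algebra.Properties.Ring ring using (-0#≈0#)
  open IntegerMultiples R using (module Solver)
  open Solver using (solve; _:=_; _:+_; _:*_; _:-_; :-_)

  involution⇒Step : ∀ {x y} → Involution R (x - y) → Step rawRing x y
  involution⇒Step {x} {y} x-y-involution with x ≟ y
  ... | yes x≈y = inj₂ x≈y
  ... | no  x≉y = inj₁ (x≉y , x-y-involution)

  ≈⇒Reachable : ∀ {x y} → x ≈ y → Reachable rawRing x y
  ≈⇒Reachable x≈y = inj₂ x≈y ◅ ε

  Step-+ˡ : ∀ a {x y} → Step rawRing x y → Step rawRing (a + x) (a + y)
  Step-+ˡ a         (inj₂ x≈y)                 = inj₂ (+-congˡ x≈y)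
  Step-+ˡ a {x} {y} (inj₁ (_ , x-y-involution)) = involution⇒Step (trans (*-cong difference difference) x-y-involution)
    where
    difference : (a + x) - (a + y) ≈ x - y
    difference = solve 3 (λ a x y → (a :+ x) :- (a :+ y) := x :- y) refl a x y

  Step-‿ : ∀ {x y} → Step rawRing x y → Step rawRing (- x) (- y)
  Step-‿         (inj₂ x≈y)                 = inj₂ (-‿cong x≈y)
  Step-‿ {x} {y} (inj₁ (_ , x-y-involution)) = involution⇒Step (trans square x-y-involution)
    where
    square : (- x - - y) * (- x - - y) ≈ (x - y) * (x - y)
    square = solve 2 (λ x y → (:- x :- :- y) :* (:- x :- :- y) := (x :- y) :* (x :- y)) refl x y

  Component₀ : Pred Carrier (c ⊔ ℓ)
  Component₀ = Reachable rawRing 0#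

  Component₀-isAdditiveSubgroup : IsAdditiveSubgroup R Component₀
  Component₀-isAdditiveSubgroup = record
    { ∈-resp   = λ x≈y 0⇝x → 0⇝x ◅◅ ≈⇒Reachable x≈y
    ; 0∈       = ε
    ; +-closed = λ {x} 0⇝x 0⇝y → 0⇝x ◅◅ ≈⇒Reachable (sym (+-identityʳ x)) ◅◅ gmap (_+_ x) (Step-+ˡ x) 0⇝y
    ; -‿closed = λ 0⇝x → ≈⇒Reachable (sym -0#≈0#) ◅◅ gmap -_ Step-‿ 0⇝x
    }

  involution∈Component₀ : ∀ {u} → Involution R u → u ∈ Component₀
  involution∈Component₀ {u} u-involution = involution⇒Step (trans square u-involution) ◅ ε
    where
    square : (0# - u) * (0# - u) ≈ u * u
    square = solve 1 (λ u → (Solver.con (+ 0) :- u) :* (Solver.con (+ 0) :- u) := u :* u) refl u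

  Component₀⊆ : ∀ {p} {S : Pred Carrier p} → IsAdditiveSubgroup R S →
                (∀ {u} → Involution R u → u ∈ S) → Component₀ ⊆ S
  Component₀⊆ {S = S} S-isSubgroup involution∈S = along (IsAdditiveSubgroup.0∈ S-isSubgroup)
    where
    open IsAdditiveSubgroup S-isSubgroup
    along : ∀ {x y} → x ∈ S → Reachable rawRing x y → y ∈ S
    along x∈S ε                                   = x∈S
    along x∈S (inj₂ x≈y ◅ y⇝z)                    = along (∈-resp x≈y x∈S) y⇝z
    along {x} x∈S (_◅_ {j = y} (inj₁ (_ , x-y-involution)) y⇝z) =
      along (∈-resp x-[x-y]≈y (difference-closed x∈S (involution∈S x-y-involution))) y⇝z
      where x-[x-y]≈y = solve 2 (λ x y → x :- (x :- y) := y) refl x y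

  Component₀-universal⇒connected : (∀ x → x ∈ Component₀) → ΓConnected rawRing
  Component₀-universal⇒connected 0⇝ x y =
    ≈⇒Reachable (sym (+-identityʳ x)) ◅◅ gmap (_+_ x) (Step-+ˡ x) (0⇝ (y - x)) ◅◅ ≈⇒Reachable x+[y-x]≈y
    where x+[y-x]≈y = solve 2 (λ x y → x :+ (y :- x) := y) refl x y

module Ideals (R : CommutativeRing c ℓ) where
  open CommutativeRing R
  open IntegerMultiples R using (module Solver)
  open Solver using (solve; _:=_; _:+_; _:*_)

  maximal⇒em : ∀ {M} → IsMaximalIdeal R M → ExcludedMiddle (c ⊔ ℓ)
  maximal⇒em {M} M-maximal {P} with maximal (λ x → x ∈ M ⊎ P) M⊎P-isIdeal inj₁
    where
    open IsMaximalIdeal M-maximal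
    open IsIdeal isIdeal
    M⊎P-isIdeal : IsIdeal R (λ x → x ∈ M ⊎ P)
    M⊎P-isIdeal = record
      { resp     = λ { x≈y (inj₁ x∈M) → inj₁ (resp x≈y x∈M) ; _ (inj₂ p) → inj₂ p }
      ; zero∈    = inj₁ zero∈
      ; +-closed = λ { (inj₁ x∈M) (inj₁ y∈M) → inj₁ (+-closed x∈M y∈M)
                     ; (inj₂ p)   _          → inj₂ p
                     ; _          (inj₂ p)   → inj₂ p }
      ; *-closed = λ { r (inj₁ x∈M) → inj₁ (*-closed r x∈M) ; _ (inj₂ p) → inj₂ p }
      }
  ... | inj₁ M⊎P⊆M      = no λ p → IsMaximalIdeal.proper M-maximal (M⊎P⊆M (inj₂ p))
  ... | inj₂ (inj₁ 1∈M) = contradiction 1∈M (IsMaximalIdeal.proper M-maximal)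
  ... | inj₂ (inj₂ p)   = yes p

  ｛0｝ : Pred Carrier (c ⊔ ℓ)
  ｛0｝ x = Lift c (x ≈ 0#)

  ｛0｝-isIdeal : IsIdeal R ｛0｝
  ｛0｝-isIdeal = record
    { resp     = λ { x≈y (lift x≈0) → lift (trans (sym x≈y) x≈0) }
    ; zero∈    = lift refl
    ; +-closed = λ { (lift x≈0) (lift y≈0) → lift (trans (+-cong x≈0 y≈0) (+-identityʳ 0#)) }
    ; *-closed = λ { r (lift x≈0) → lift (trans (*-congˡ x≈0) (zeroʳ r)) }
    }

  infixl 6 _+⟨_⟩

  _+⟨_⟩ : Pred Carrier (c ⊔ ℓ) → Carrier → Pred Carrier (c ⊔ ℓ)
  (I +⟨ x ⟩) y = ∃₂ λ i r → i ∈ I × y ≈ i + r * x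

  module _ {I : Pred Carrier (c ⊔ ℓ)} (I-isIdeal : IsIdeal R I) where
    open IsIdeal I-isIdeal

    +⟨⟩-isIdeal : ∀ x → IsIdeal R (I +⟨ x ⟩)
    +⟨⟩-isIdeal x = record
      { resp     = λ { y≈z (i , r , i∈I , y≈i+rx) → i , r , i∈I , trans (sym y≈z) y≈i+rx }
      ; zero∈    = 0# , 0# , zero∈ , sym (trans (+-congˡ (zeroˡ x)) (+-identityʳ 0#))
      ; +-closed = λ { (i , r , i∈I , y≈) (j , s , j∈I , z≈) → i + j , r + s , +-closed i∈I j∈I ,
          trans (+-cong y≈ z≈) (solve 5 (λ i r j s x → (i :+ r :* x) :+ (j :+ s :* x) := (i :+ j) :+ (r :+ s) :* x)
                                        refl i r j s x) }
      ; *-closed = λ { a (i , r , i∈I , y≈) → a * i , a * r , *-closed a i∈I ,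
          trans (*-congˡ y≈) (solve 4 (λ a i r x → a :* (i :+ r :* x) := a :* i :+ (a :* r) :* x) refl a i r x) }
      }

    ⊆+⟨⟩ : ∀ x → I ⊆ I +⟨ x ⟩
    ⊆+⟨⟩ x {y} y∈I = y , 0# , y∈I , sym (trans (+-congˡ (zeroˡ x)) (+-identityʳ y))

    x∈+⟨x⟩ : ∀ x → x ∈ I +⟨ x ⟩
    x∈+⟨x⟩ x = 0# , 1# , zero∈ , sym (trans (+-identityˡ _) (*-identityˡ x))

  +⟨⟩-monoˡ : ∀ {I J x} → I ⊆ J → I +⟨ x ⟩ ⊆ J +⟨ x ⟩
  +⟨⟩-monoˡ I⊆J (i , r , i∈I , y≈) = i , r , I⊆J i∈I , y≈

  +⟨⟩-least : ∀ {I J x} → IsIdeal R J → I ⊆ J → x ∈ J → I +⟨ x ⟩ ⊆ J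
  +⟨⟩-least J-isIdeal I⊆J x∈J (i , r , i∈I , y≈) = resp (sym y≈) (+-closed (I⊆J i∈I) (*-closed r x∈J))
    where open IsIdeal J-isIdeal

  1∈｛0｝+⟨x⟩⇒unit : ∀ {x} → 1# ∈ ｛0｝ +⟨ x ⟩ → Unit R x
  1∈｛0｝+⟨x⟩⇒unit {x} (i , r , lift i≈0 , 1≈i+rx) =
    r , sym (trans 1≈i+rx (trans (+-congʳ i≈0) (trans (+-identityˡ _) (*-comm r x))))

  Decides : Pred Carrier (c ⊔ ℓ) → Carrier → Set (c ⊔ ℓ)
  Decides N x = x ∈ N ⊎ 1# ∈ N +⟨ x ⟩

  Decides-monoˡ : ∀ {I J x} → I ⊆ J → Decides I x → Decides J x
  Decides-monoˡ I⊆J (inj₁ x∈I)   = inj₁ (I⊆J x∈I)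
  Decides-monoˡ I⊆J (inj₂ 1∈I+x) = inj₂ (+⟨⟩-monoˡ I⊆J 1∈I+x)

  Decides-resp : ∀ {N x y} → IsIdeal R N → x ≈ y → Decides N x → Decides N y
  Decides-resp N-isIdeal x≈y (inj₁ x∈N)                       = inj₁ (IsIdeal.resp N-isIdeal x≈y x∈N)
  Decides-resp N-isIdeal x≈y (inj₂ (i , r , i∈N , 1≈i+rx)) = inj₂ (i , r , i∈N , trans 1≈i+rx (+-congˡ (*-congˡ x≈y)))

  record ProperExtension (I : Pred Carrier (c ⊔ ℓ)) {k} (xs : Vector Carrier k) : Set (Level.suc (c ⊔ ℓ)) where
    field
      N       : Pred Carrier (c ⊔ ℓ)
      isIdeal : IsIdeal R N
      proper  : 1# ∉ N
      I⊆N     : I ⊆ N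
      decides : ∀ i → Decides N (xs i)

  ProperExtension-∷ : ∀ {I J k} {xs : Vector Carrier (suc k)} → IsIdeal R J → 1# ∉ J → I ⊆ J →
                      Decides J (head xs) → ProperExtension J (tail xs) → ProperExtension I xs
  ProperExtension-∷ _ _ I⊆J decides₀ extension = record
    { N       = N
    ; isIdeal = isIdeal
    ; proper  = proper
    ; I⊆N     = I⊆N ∘ I⊆J
    ; decides = λ { Fin.zero → Decides-monoˡ I⊆N decides₀ ; (Fin.suc i) → decides i }
    }
    where open ProperExtension extension

  module _ (em : ExcludedMiddle (c ⊔ ℓ)) where

    -- Krull's lemma for finite rings: run through an enumeration of R, adjoining each
    -- element unless that makes the ideal improper.
    extend : ∀ {I} → IsIdeal R I → 1# ∉ I → ∀ {k} (xs : Vector Carrier k) → ProperExtension I xs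
    extend {I} I-isIdeal 1∉I {zero} xs = record
      { N = I ; isIdeal = I-isIdeal ; proper = 1∉I ; I⊆N = id ; decides = λ () }
    extend {I} I-isIdeal 1∉I {suc k} xs with em {1# ∈ I +⟨ head xs ⟩}
    ... | yes 1∈I+x = ProperExtension-∷ I-isIdeal 1∉I id (inj₂ 1∈I+x) (extend I-isIdeal 1∉I (tail xs))
    ... | no  1∉I+x = ProperExtension-∷ (+⟨⟩-isIdeal I-isIdeal x) 1∉I+x (⊆+⟨⟩ I-isIdeal x) (inj₁ (x∈+⟨x⟩ I-isIdeal x))
                        (extend (+⟨⟩-isIdeal I-isIdeal x) 1∉I+x (tail xs))
      where x = head xs

    decidesAll⇒maximal : ∀ {N} → IsIdeal R N → 1# ∉ N → (∀ x → Decides N x) → IsMaximalIdeal R N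
    decidesAll⇒maximal {N} N-isIdeal 1∉N decides = record { isIdeal = N-isIdeal ; proper = 1∉N ; maximal = maximal }
      where
      maximal : ∀ J → IsIdeal R J → N ⊆ J → J ⊆ N ⊎ 1# ∈ J
      maximal J J-isIdeal N⊆J with em {∃[ y ] y ∈ J × y ∉ N}
      ... | yes (y , y∈J , y∉N) = inj₂ ([ flip contradiction y∉N , +⟨⟩-least J-isIdeal N⊆J y∈J ] (decides y))
      ... | no  J⊈N             = inj₁ λ {y} y∈J → em⇒dne em λ y∉N → J⊈N (y , y∈J , y∉N)

    finite⇒maximal⊇ : IsFinite R → ∀ {I} → IsIdeal R I → 1# ∉ I → ∃[ M ] IsMaximalIdeal R M × I ⊆ M
    finite⇒maximal⊇ (_ , enumeration) I-isIdeal 1∉I =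
      N , decidesAll⇒maximal isIdeal proper (λ x → Decides-resp isIdeal (strictlyInverseˡ x) (decides (from x))) , I⊆N
      where
      open Inverse enumeration
      open ProperExtension (extend I-isIdeal 1∉I to)

module FiniteRing (R : CommutativeRing c ℓ) (finite : IsFinite R) where
  open CommutativeRing R
  open Algebra.Properties.Ring ring using (-‿involutive; -0#≈0#; +-identityʳ-unique; x∙y⁻¹≈ε⇒x≈y; x≈y⇒x∙y⁻¹≈ε)
  open IntegerMultiples R
  open Relation.Binary.Reasoning.Setoid setoid

  size : ℕ
  size = proj₁ finite

  open Inverse (proj₂ finite) using (to; from; from-cong; strictlyInverseˡ; strictlyInverseʳ)

  fromInjection : Injection setoid (≡.setoid (Fin size))
  fromInjection = Inverse⇒Injection (Symmetry.inverse (proj₂ finite))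

  _≟_ : Decidable _≈_
  _≟_ = Fin.inj⇒≟ fromInjection

  private
    positiveZero : ∃[ k ] fromℕ (suc k) ≈ 0#
    positiveZero with Fin.pigeonhole (ℕ.n<1+n size) (λ i → from (fromℕ (toℕ i)))
    ... | i , j , i<j , from≡ = toℕ j ℕ.∸ suc (toℕ i) , +-identityʳ-unique (fromℕ a) _ (begin
        fromℕ a + fromℕ (suc k)   ≈⟨ fromℕ-homo-+ a (suc k) ⟨
        fromℕ (a ℕ.+ suc k)       ≡⟨ ≡.cong fromℕ (ℕ.+-suc a k) ⟩
        fromℕ (suc a ℕ.+ k)       ≡⟨ ≡.cong fromℕ (ℕ.m+[n∸m]≡n i<j) ⟩
        fromℕ (toℕ j)             ≈⟨ Injection.injective fromInjection from≡ ⟨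
        fromℕ a                   ∎)
      where
      a = toℕ i
      k = toℕ j ℕ.∸ suc a

    leastPositiveZero : ∃[ m ] fromℕ (suc m) ≈ 0# × (∀ {k} → k ℕ.< m → ¬ fromℕ (suc k) ≈ 0#)
    leastPositiveZero = leastWitness (λ k → fromℕ (suc k) ≟ 0#) {proj₁ positiveZero} (proj₂ positiveZero)

  opaque
    char : ℕ
    char = suc (proj₁ leastPositiveZero)

    instance
      char-nonZero : NonZero char
      char-nonZero = _

    fromℕ-char≈0 : fromℕ char ≈ 0#
    fromℕ-char≈0 = proj₁ (proj₂ leastPositiveZero)

    char-minimal : ∀ {n} → suc n ℕ.< char → ¬ fromℕ (suc n) ≈ 0#
    char-minimal n<char = proj₂ (proj₂ leastPositiveZero) (ℕ.≤-pred n<char)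

  char∣⇒fromℕ≈0 : ∀ {k} → char ℕ.∣ k → fromℕ k ≈ 0#
  char∣⇒fromℕ≈0 (divides q ≡.refl) = trans (fromℕ-homo-* q char) (trans (*-congˡ fromℕ-char≈0) (zeroʳ _))

  fromℕ≈0⇒char∣ : ∀ k → fromℕ k ≈ 0# → char ℕ.∣ k
  fromℕ≈0⇒char∣ k k≈0 = ℕ.m%n≡0⇒n∣m k char (remainder≡0 (k % char) ≡.refl (m%n<n k char))
    where
    remainder≈0 : fromℕ (k % char) ≈ 0#
    remainder≈0 = begin
      fromℕ (k % char)                              ≈⟨ +-identityʳ _ ⟨
      fromℕ (k % char) + 0#                         ≈⟨ +-congˡ (char∣⇒fromℕ≈0 (divides (k / char) ≡.refl)) ⟨
      fromℕ (k % char) + fromℕ (k / char ℕ.* char)  ≈⟨ fromℕ-homo-+ (k % char) _ ⟨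
      fromℕ (k % char ℕ.+ k / char ℕ.* char)        ≡⟨ ≡.cong fromℕ (m≡m%n+[m/n]*n k char) ⟨
      fromℕ k                                      ≈⟨ k≈0 ⟩
      0#                                           ∎
    remainder≡0 : ∀ r → r ≡ k % char → r ℕ.< char → r ≡ 0
    remainder≡0 zero    _      _       = ≡.refl
    remainder≡0 (suc r) r≡k%c r<char =
      contradiction (≡.subst (λ r → fromℕ r ≈ 0#) (≡.sym r≡k%c) remainder≈0) (char-minimal r<char)

  char≡q*p⇒fromℕq≉0 : ∀ {q p} → char ≡ q ℕ.* p → 1 ℕ.< p → ¬ fromℕ q ≈ 0#
  char≡q*p⇒fromℕq≉0 {zero}  char≡0   _   _   = ℕ.≢-nonZero⁻¹ char char≡0
  char≡q*p⇒fromℕq≉0 {suc q} {p} char≡q*p 1<p q≈0 = ℕ.<⇒≱ q<char (ℕ.∣⇒≤ (fromℕ≈0⇒char∣ (suc q) q≈0))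
    where q<char = ≡.subst (suc q ℕ.<_) (≡.sym char≡q*p) (ℕ.m<m*n (suc q) p 1<p)

  fromℤ≈0⇒char∣ : ∀ z → fromℤ z ≈ 0# → char ℕ.∣ ∣ z ∣
  fromℤ≈0⇒char∣ (+ n)    = fromℕ≈0⇒char∣ n
  fromℤ≈0⇒char∣ -[1+ n ] -n≈0 = fromℕ≈0⇒char∣ (suc n) (trans (sym (-‿involutive _)) (trans (-‿cong -n≈0) -0#≈0#))

  char∣⇒fromℤ≈0 : ∀ z → char ℕ.∣ ∣ z ∣ → fromℤ z ≈ 0#
  char∣⇒fromℤ≈0 (+ n)    = char∣⇒fromℕ≈0
  char∣⇒fromℤ≈0 -[1+ n ] char∣n = trans (-‿cong (char∣⇒fromℕ≈0 char∣n)) -0#≈0#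

  integral⇒≅ℤmod : (∀ x → ∃[ z ] x ≈ fromℤ z) → rawRing ≅ʳ ℤmod char
  integral⇒≅ℤmod integral = f , record
    { isRingMonomorphism = record
      { isRingHomomorphism = record
        { isSemiringHomomorphism = record
          { isNearSemiringHomomorphism = record
            { +-isMonoidHomomorphism = record
              { isMagmaHomomorphism = record
                { isRelHomomorphism = record { cong = λ {x} {y} x≈y → f-≡mod (trans x≈y (f-spec y)) }
                ; homo = λ x y → f-≡mod (trans (+-cong (f-spec x) (f-spec y)) (sym (fromℤ-homo-+ (f x) (f y))))
                }
              ; ε-homo = f-≡mod {z = + 0} refl
              }
            ; *-homo = λ x y → f-≡mod (trans (*-cong (f-spec x) (f-spec y)) (sym (fromℤ-homo-* (f x) (f y))))
            }
          ; 1#-homo = f-≡mod {z = + 1} refl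
          }
        ; -‿homo = λ x → f-≡mod (trans (-‿cong (f-spec x)) (sym (fromℤ-homo-‿ (f x))))
        }
      ; injective = λ {x} {y} fx≡fy →
          trans (f-spec x) (trans (x∙y⁻¹≈ε⇒x≈y _ _ (fromℤ-difference≈0 {f x} {f y} fx≡fy)) (sym (f-spec y)))
      }
    ; surjective = λ z → fromℤ z , f-≡mod
    }
    where
    f : Carrier → ℤ
    f = proj₁ ∘ integral
    f-spec : ∀ x → x ≈ fromℤ (f x)
    f-spec = proj₂ ∘ integral
    f-≡mod : ∀ {x z} → x ≈ fromℤ z → (+ char) ℤ.∣ (f x ℤ.- z)
    f-≡mod {x} {z} x≈z =
      fromℤ≈0⇒char∣ (f x ℤ.- z) (trans (fromℤ-homo-sub (f x) z) (x≈y⇒x∙y⁻¹≈ε (trans (sym (f-spec x)) x≈z)))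
    fromℤ-difference≈0 : ∀ {a b} → (+ char) ℤ.∣ (a ℤ.- b) → fromℤ a - fromℤ b ≈ 0#
    fromℤ-difference≈0 {a} {b} char∣a-b = trans (sym (fromℤ-homo-sub a b)) (char∣⇒fromℤ≈0 (a ℤ.- b) char∣a-b)

  order2⇒2∣size : ∀ {x} → ¬ x ≈ 0# → x + x ≈ 0# → 2 ℕ.∣ size
  order2⇒2∣size {x} x≉0 x+x≈0 = fixedPointFreeInvolution⇒2∣n τ τ∘τ≡id τk≢k
    where
    τ : Fin size → Fin size
    τ k = from (to k + x)
    τ∘τ≡id : ∀ k → τ (τ k) ≡ k
    τ∘τ≡id k = ≡.trans (from-cong (begin
      to (τ k) + x    ≈⟨ +-congʳ (strictlyInverseˡ _) ⟩
      (to k + x) + x  ≈⟨ +-assoc _ _ _ ⟩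
      to k + (x + x)  ≈⟨ +-congˡ x+x≈0 ⟩
      to k + 0#       ≈⟨ +-identityʳ _ ⟩
      to k            ∎)) (strictlyInverseʳ k)
    τk≢k : ∀ k → τ k ≢ k
    τk≢k k τk≡k = x≉0 (+-identityʳ-unique (to k) x (trans (sym (strictlyInverseˡ _)) (reflexive (≡.cong to τk≡k))))

module LocalRing (R : CommutativeRing c ℓ) (finite : IsFinite R) (local : IsLocal R) where
  open CommutativeRing R
  open Algebra.Properties.Ring ring using (-1*x≈-x; x∙y⁻¹≈ε⇒x≈y)
  open IntegerMultiples R
  open Solver using (solve; _:=_; _:+_; _:*_; _:-_; :-_; con)
  open Ideals R
  open FiniteRing R finite
  open Relation.Binary.Reasoning.Setoid setoid

  M : Pred Carrier (c ⊔ ℓ)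
  M = proj₁ local

  M-isMaximal : IsMaximalIdeal R M
  M-isMaximal = proj₁ (proj₂ local)

  open IsMaximalIdeal M-isMaximal public using (proper)
  open IsIdeal (IsMaximalIdeal.isIdeal M-isMaximal) public using (resp; zero∈; *-closed)

  em : ExcludedMiddle (c ⊔ ℓ)
  em = maximal⇒em M-isMaximal

  x-y∈M : ∀ {x y} → x ∈ M → y ∈ M → x - y ∈ M
  x-y∈M {y = y} x∈M y∈M = IsIdeal.+-closed (IsMaximalIdeal.isIdeal M-isMaximal) x∈M (resp (-1*x≈-x y) (*-closed (- 1#) y∈M))

  nonunit∈M : ∀ {x} → ¬ Unit R x → x ∈ M
  nonunit∈M {x} x-nonunit with finite⇒maximal⊇ em finite (+⟨⟩-isIdeal ｛0｝-isIdeal x) (x-nonunit ∘ 1∈｛0｝+⟨x⟩⇒unit)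
  ... | N , N-isMaximal , ⟨x⟩⊆N = proj₁ (proj₂ (proj₂ local) N N-isMaximal) (⟨x⟩⊆N (x∈+⟨x⟩ ｛0｝-isIdeal x))

  unit⇒∉M : ∀ {x} → Unit R x → x ∉ M
  unit⇒∉M {x} (y , xy≈1) x∈M = proper (resp (trans (*-comm y x) xy≈1) (*-closed y x∈M))

  ∉M⇒cancelˡ : ∀ {x y} → x ∉ M → x * y ≈ 0# → y ≈ 0#
  ∉M⇒cancelˡ {x} {y} x∉M xy≈0 with em⇒dne em (x∉M ∘ nonunit∈M)
  ... | z , xz≈1 = begin
    y              ≈⟨ *-identityˡ y ⟨
    1# * y         ≈⟨ *-congʳ xz≈1 ⟨
    (x * z) * y    ≈⟨ solve 3 (λ x y z → (x :* z) :* y := z :* (x :* y)) refl x y z ⟩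
    z * (x * y)    ≈⟨ *-congˡ xy≈0 ⟩
    z * 0#         ≈⟨ zeroʳ z ⟩
    0#             ∎

  involution-factorisation : ∀ {u} → Involution R u → (u - 1#) * (u - - 1#) ≈ 0#
  involution-factorisation {u} u²≈1 = begin
    (u - 1#) * (u - - 1#)  ≈⟨ solve 1 (λ u → (u :- con (+ 1)) :* (u :- :- con (+ 1)) := u :* u :- con (+ 1)) refl u ⟩
    u * u - 1#             ≈⟨ +-congʳ u²≈1 ⟩
    1# - 1#                ≈⟨ -‿inverseʳ 1# ⟩
    0#                     ∎

  2∈M⇒involution-1∈M : ∀ {u} → fromℕ 2 ∈ M → Involution R u → u - 1# ∈ M
  2∈M⇒involution-1∈M {u} 2∈M u²≈1 = em⇒dne em λ u-1∉M → u-1∉M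
    (resp (solve 1 (λ u → (u :- :- con (+ 1)) :- con (+ 2) := u :- con (+ 1)) refl u)
          (x-y∈M (resp (sym (∉M⇒cancelˡ u-1∉M (involution-factorisation u²≈1))) zero∈) 2∈M))

  2∉M⇒involution≈±1 : ∀ {u} → fromℕ 2 ∉ M → Involution R u → u ≈ 1# ⊎ u ≈ - 1#
  2∉M⇒involution≈±1 {u} 2∉M u²≈1 with em {u - 1# ∈ M}
  ... | no  u-1∉M = inj₂ (x∙y⁻¹≈ε⇒x≈y u (- 1#) (∉M⇒cancelˡ u-1∉M (involution-factorisation u²≈1)))
  ... | yes u-1∈M = inj₁ (x∙y⁻¹≈ε⇒x≈y u 1# (∉M⇒cancelˡ u+1∉M (trans (*-comm _ _) (involution-factorisation u²≈1))))
    where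
    u+1∉M : u - - 1# ∉ M
    u+1∉M u+1∈M = 2∉M (resp [u+1]-[u-1]≈2 (x-y∈M u+1∈M u-1∈M))
      where [u+1]-[u-1]≈2 = solve 1 (λ u → (u :- :- con (+ 1)) :- (u :- con (+ 1)) := con (+ 2)) refl u

  2∈M⇒Step-parity : ∀ {x y} → fromℕ 2 ∈ M → Involution R (x - y) →
                    (x ∈ M → y - 1# ∈ M) × (x - 1# ∈ M → y ∈ M)
  2∈M⇒Step-parity {x} {y} 2∈M x-y-involution =
    (λ x∈M → resp e₁ (x-y∈M (x-y∈M x∈M w∈M) 2∈M)) , (λ x-1∈M → resp e₂ (x-y∈M x-1∈M w∈M))
    where
    w∈M : (x - y) - 1# ∈ M
    w∈M = 2∈M⇒involution-1∈M 2∈M x-y-involution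
    e₁ : (x - ((x - y) - 1#)) - fromℕ 2 ≈ y - 1#
    e₁ = solve 2 (λ x y → (x :- ((x :- y) :- con (+ 1))) :- con (+ 2) := y :- con (+ 1)) refl x y
    e₂ : (x - 1#) - ((x - y) - 1#) ≈ y
    e₂ = solve 2 (λ x y → (x :- con (+ 1)) :- ((x :- y) :- con (+ 1)) := y) refl x y

  char≡q*p⇒fromℕp∈M : ∀ {q p} → char ≡ q ℕ.* p → 1 ℕ.< p → fromℕ p ∈ M
  char≡q*p⇒fromℕp∈M {q} {p} char≡q*p 1<p = em⇒dne em λ p∉M →
    char≡q*p⇒fromℕq≉0 {q} {p} char≡q*p 1<p (∉M⇒cancelˡ p∉M (begin
      fromℕ p * fromℕ q  ≈⟨ *-comm _ _ ⟩
      fromℕ q * fromℕ p  ≈⟨ fromℕ-homo-* q p ⟨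
      fromℕ (q ℕ.* p)    ≡⟨ ≡.cong fromℕ char≡q*p ⟨
      fromℕ char         ≈⟨ fromℕ-char≈0 ⟩
      0#                 ∎))

  private
    1+u≈v⇒⊥ : ∀ {u v} → u ∈ M → v ∈ M → 1# + u ≈ v → ⊥
    1+u≈v⇒⊥ {u} {v} u∈M v∈M 1+u≈v =
      proper (resp (trans (+-congʳ (sym 1+u≈v)) [1+u]-u≈1) (x-y∈M v∈M u∈M))
      where [1+u]-u≈1 = solve 1 (λ u → (con (+ 1) :+ u) :- u := con (+ 1)) refl u

    fromℕ-Bézout : ∀ x a y b → suc (x ℕ.* a) ≡ y ℕ.* b → 1# + fromℕ x * fromℕ a ≈ fromℕ y * fromℕ b
    fromℕ-Bézout x a y b 1+xa≡yb = begin
      1# + fromℕ x * fromℕ a  ≈⟨ +-congˡ (fromℕ-homo-* x a) ⟨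
      1# + fromℕ (x ℕ.* a)    ≈⟨ fromℕ-suc (x ℕ.* a) ⟨
      fromℕ (suc (x ℕ.* a))   ≡⟨ ≡.cong fromℕ 1+xa≡yb ⟩
      fromℕ (y ℕ.* b)         ≈⟨ fromℕ-homo-* y b ⟩
      fromℕ y * fromℕ b       ∎

  coprime⇒¬bothInM : ∀ {a b} → Coprime a b → fromℕ a ∈ M → fromℕ b ∈ M → ⊥
  coprime⇒¬bothInM {a} {b} coprime a∈M b∈M with coprime-Bézout coprime
  ... | Bézout.+- x y 1+yb≡xa =
    1+u≈v⇒⊥ (*-closed (fromℕ y) b∈M) (*-closed (fromℕ x) a∈M) (fromℕ-Bézout y b x a 1+yb≡xa)
  ... | Bézout.-+ x y 1+xa≡yb =
    1+u≈v⇒⊥ (*-closed (fromℕ x) a∈M) (*-closed (fromℕ y) b∈M) (fromℕ-Bézout x a y b 1+xa≡yb)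

  prime∣char⇒∈M : ∀ {p} → Prime p → p ℕ.∣ char → fromℕ p ∈ M
  prime∣char⇒∈M {p} p-prime (divides q char≡q*p) =
    char≡q*p⇒fromℕp∈M {q} {p} char≡q*p (ℕ.nonTrivial⇒n>1 p {{prime⇒nonTrivial p-prime}})

  primeDivisors-equal : ∀ {p q} → Prime p → Prime q → p ℕ.∣ char → q ℕ.∣ char → p ≡ q
  primeDivisors-equal {p} {q} p-prime q-prime p∣char q∣char = decidable-stable (p ℕ.≟ q) λ p≢q →
    coprime⇒¬bothInM (distinctPrimes⇒coprime p-prime q-prime p≢q)
                     (prime∣char⇒∈M p-prime p∣char) (prime∣char⇒∈M q-prime q∣char)

  char≡p^k : ∃₂ λ p k → Prime p × char ≡ p ℕ.^ suc k
  char≡p^k with factorise char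
  ... | record { factors = [] ; isFactorisation = char≡1 } =
    contradiction (resp (trans (sym fromℕ-char≈0) (reflexive (≡.cong fromℕ char≡1))) zero∈) proper
  ... | record { factors = p ∷ ps ; isFactorisation = char≡p*ps ; factorsPrime = p-prime ∷ ps-prime } =
    p , length ps , p-prime ,
    ≡.trans char≡p*ps (≡.cong (p ℕ.*_) (product≡^length ps (equal-p ps ps-prime ps∣char)))
    where
    p∣char : p ℕ.∣ char
    p∣char = divides (product ps) (≡.trans char≡p*ps (ℕ.*-comm p _))
    ps∣char : product ps ℕ.∣ char
    ps∣char = divides p char≡p*ps
    equal-p : ∀ qs → All Prime qs → product qs ℕ.∣ char → All (_≡ p) qs
    equal-p []       []                   _         = []
    equal-p (q ∷ qs) (q-prime ∷ qs-prime) q*qs∣char =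
      primeDivisors-equal q-prime p-prime (ℕ.∣-trans (ℕ.m∣m*n (product qs)) q*qs∣char) p∣char
      ∷ equal-p qs qs-prime (ℕ.∣-trans (ℕ.n∣m*n q) q*qs∣char)

  2∉M⇒2∤char : fromℕ 2 ∉ M → ¬ 2 ℕ.∣ char
  2∉M⇒2∤char 2∉M (divides h char≡h*2) = 2∉M (char≡q*p⇒fromℕp∈M {h} {2} char≡h*2 (s≤s (s≤s z≤n)))

  2∈M⇒2∣char : fromℕ 2 ∈ M → 2 ℕ.∣ char
  2∈M⇒2∣char 2∈M = decidable-stable (2 ∣? char) λ 2∤char → unit⇒∉M (odd⇒2-unit 2∤char fromℕ-char≈0) 2∈M

  2∈M⇒evenSize : fromℕ 2 ∈ M → EvenSize R
  2∈M⇒evenSize 2∈M with 2∈M⇒2∣char 2∈M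
  ... | divides h char≡h*2 =
    size , proj₂ finite , order2⇒2∣size (char≡q*p⇒fromℕq≉0 {h} {2} char≡h*2 (s≤s (s≤s z≤n))) (begin
      fromℕ h + fromℕ h   ≈⟨ fromℕ-homo-+ h h ⟨
      fromℕ (h ℕ.+ h)     ≡⟨ ≡.cong fromℕ (≡.trans (x+x≡x*2 h) (≡.sym char≡h*2)) ⟩
      fromℕ char          ≈⟨ fromℕ-char≈0 ⟩
      0#                  ∎)

  2∉M⇒ℤOddPrimePower : ΓConnectedRing R → fromℕ 2 ∉ M → IsZOddPrimePower R
  2∉M⇒ℤOddPrimePower connected 2∉M with char≡p^k
  ... | p , k , p-prime , char≡p^k =
    p , suc k , p-prime , 2∤p , s≤s z≤n , ≡.subst (λ m → rawRing ≅ʳ ℤmod m) char≡p^k (integral⇒≅ℤmod integral)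
    where
    open InvolutoryCayleyGraph R _≟_
    2∤p : ¬ 2 ℕ.∣ p
    2∤p 2∣p = 2∉M⇒2∤char 2∉M (ℕ.∣-trans 2∣p (divides (p ℕ.^ k) (≡.trans char≡p^k (ℕ.*-comm p _))))
    involution∈Integral : ∀ {u} → Involution R u → Integral R u
    involution∈Integral u²≈1 = [ (+ 1 ,_) , (-[1+ 0 ] ,_) ] (2∉M⇒involution≈±1 2∉M u²≈1)
    integral : ∀ x → Integral R x
    integral x = Component₀⊆ (Integral-isAdditiveSubgroup R) involution∈Integral (connected 0# x)

module ModularArithmetic (m : ℕ) where
  open import Data.Integer.Tactic.RingSolver using (solve-∀)

  infix 4 _≡ₘ_

  _≡ₘ_ : ℤ → ℤ → Set
  _≡ₘ_ = RawRing._≈_ (ℤmod m)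

  private
    signed : ∀ a b → a ≡ₘ b → (+ m) ℤˢ.∣ (a ℤ.- b)
    signed a b = ℤˢ.∣ᵤ⇒∣ {+ m} {a ℤ.- b}
    unsigned : ∀ a b → (+ m) ℤˢ.∣ (a ℤ.- b) → a ≡ₘ b
    unsigned a b = ℤˢ.∣⇒∣ᵤ {+ m} {a ℤ.- b}

  ≡ₘ-refl : ∀ {a} → a ≡ₘ a
  ≡ₘ-refl {a} = ≡.subst (λ z → m ℕ.∣ ∣ z ∣) (≡.sym (ℤ.+-inverseʳ a)) (m ℕ.∣0)

  ≡ₘ-sym : ∀ {a b} → a ≡ₘ b → b ≡ₘ a
  ≡ₘ-sym {a} {b} a≡b = unsigned b a (≡.subst ((+ m) ℤˢ.∣_) (lemma a b) (ℤˢ.∣m⇒∣-m (signed a b a≡b)))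
    where
    lemma : ∀ a b → ℤ.- (a ℤ.- b) ≡ b ℤ.- a
    lemma = solve-∀

  ≡ₘ-trans : ∀ {a b c} → a ≡ₘ b → b ≡ₘ c → a ≡ₘ c
  ≡ₘ-trans {a} {b} {c} a≡b b≡c =
    unsigned a c (≡.subst ((+ m) ℤˢ.∣_) (lemma a b c) (ℤˢ.∣m∣n⇒∣m+n (signed a b a≡b) (signed b c b≡c)))
    where
    lemma : ∀ a b c → (a ℤ.- b) ℤ.+ (b ℤ.- c) ≡ a ℤ.- c
    lemma = solve-∀

  ≡ₘ-setoid : Setoid 0ℓ 0ℓ
  ≡ₘ-setoid = record
    { Carrier       = ℤ
    ; _≈_           = _≡ₘ_
    ; isEquivalence = record
      { refl  = λ {a} → ≡ₘ-refl {a}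
      ; sym   = λ {a} {b} → ≡ₘ-sym {a} {b}
      ; trans = λ {a} {b} {c} → ≡ₘ-trans {a} {b} {c}
      }
    }

  ≡ₘ-+ : ∀ a b c d → a ≡ₘ b → c ≡ₘ d → a ℤ.+ c ≡ₘ b ℤ.+ d
  ≡ₘ-+ a b c d a≡b c≡d =
    unsigned (a ℤ.+ c) (b ℤ.+ d) (≡.subst ((+ m) ℤˢ.∣_) (lemma a b c d) (ℤˢ.∣m∣n⇒∣m+n (signed a b a≡b) (signed c d c≡d)))
    where
    lemma : ∀ a b c d → (a ℤ.- b) ℤ.+ (c ℤ.- d) ≡ (a ℤ.+ c) ℤ.- (b ℤ.+ d)
    lemma = solve-∀

  ≡ₘ-‿ : ∀ a b → a ≡ₘ b → ℤ.- a ≡ₘ ℤ.- b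
  ≡ₘ-‿ a b a≡b = unsigned (ℤ.- a) (ℤ.- b) (≡.subst ((+ m) ℤˢ.∣_) (lemma a b) (ℤˢ.∣m⇒∣-m (signed a b a≡b)))
    where
    lemma : ∀ a b → ℤ.- (a ℤ.- b) ≡ ℤ.- a ℤ.- ℤ.- b
    lemma = solve-∀

  m≡ₘ0 : + m ≡ₘ + 0
  m≡ₘ0 = ℕ.∣-reflexive (≡.sym (ℕ.+-identityʳ m))

module ℤModIsomorphism (R : CommutativeRing c ℓ) {m} {f} (iso : RingMorphisms.IsRingIsomorphism (CommutativeRing.rawRing R) (ℤmod m) f) where
  open CommutativeRing R
  open IntegerMultiples R
  open ModularArithmetic m
  open RingMorphisms.IsRingIsomorphism iso

  f∘fromℕ≡ₘid : ∀ n → f (fromℕ n) ≡ₘ + n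
  f∘fromℕ≡ₘid zero    = 0#-homo
  f∘fromℕ≡ₘid (suc n) = begin
    f (fromℕ (suc n))     ≈⟨ ⟦⟧-cong (fromℕ-suc n) ⟩
    f (1# + fromℕ n)      ≈⟨ +-homo 1# (fromℕ n) ⟩
    f 1# ℤ.+ f (fromℕ n)  ≈⟨ ≡ₘ-+ (f 1#) (+ 1) (f (fromℕ n)) (+ n) 1#-homo (f∘fromℕ≡ₘid n) ⟩
    + 1 ℤ.+ + n           ∎
    where open Relation.Binary.Reasoning.Setoid ≡ₘ-setoid

  f∘fromℤ≡ₘid : ∀ z → f (fromℤ z) ≡ₘ z
  f∘fromℤ≡ₘid (+ n)    = f∘fromℕ≡ₘid n
  f∘fromℤ≡ₘid -[1+ n ] = begin
    f (- fromℕ (suc n))    ≈⟨ -‿homo (fromℕ (suc n)) ⟩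
    ℤ.- f (fromℕ (suc n))  ≈⟨ ≡ₘ-‿ (f (fromℕ (suc n))) (+ suc n) (f∘fromℕ≡ₘid (suc n)) ⟩
    ℤ.- + suc n            ∎
    where open Relation.Binary.Reasoning.Setoid ≡ₘ-setoid

  integral : ∀ x → x ≈ fromℤ (f x)
  integral x = sym (injective (f∘fromℤ≡ₘid (f x)))

  fromℕ-m≈0 : fromℕ m ≈ 0#
  fromℕ-m≈0 = injective (begin
    f (fromℕ m)  ≈⟨ f∘fromℕ≡ₘid m ⟩
    + m          ≈⟨ m≡ₘ0 ⟩
    + 0          ≈⟨ 0#-homo ⟨
    f 0#         ∎)
    where open Relation.Binary.Reasoning.Setoid ≡ₘ-setoid

  odd⇒multipleOf2 : ¬ 2 ℕ.∣ m → ∀ a → ∃[ z ] a ≈ fromℤ z * fromℕ 2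
  odd⇒multipleOf2 2∤m a = f (a * y) , (begin
    a                            ≈⟨ *-identityʳ a ⟨
    a * 1#                       ≈⟨ *-congˡ 2y≈1 ⟨
    a * (fromℕ 2 * y)            ≈⟨ *-congˡ (*-comm _ _) ⟩
    a * (y * fromℕ 2)            ≈⟨ *-assoc _ _ _ ⟨
    (a * y) * fromℕ 2            ≈⟨ *-congʳ (integral (a * y)) ⟩
    fromℤ (f (a * y)) * fromℕ 2  ∎)
    where
    open Relation.Binary.Reasoning.Setoid setoid
    2-unit : Unit R (fromℕ 2)
    2-unit = odd⇒2-unit 2∤m fromℕ-m≈0
    y : Carrier
    y = proj₁ 2-unit
    2y≈1 : fromℕ 2 * y ≈ 1#
    2y≈1 = proj₂ 2-unit

module Product {t : ℕ} (Rs : Fin t → CommutativeRing c ℓ) (finite : ∀ i → IsFinite (Rs i)) where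
  module R (i : Fin t) where
    open CommutativeRing (Rs i) public
    open Algebra.Properties.Ring ring public using (-‿involutive; -0#≈0#; -1*x≈-x)
    open IntegerMultiples (Rs i) public using (fromℕ; fromℤ)
    open FiniteRing (Rs i) (finite i) public using (_≟_)
    open InvolutoryCayleyGraph (Rs i) _≟_ public

  Π : CommutativeRing c ℓ
  Π = ΠCommutativeRing t Rs

  open CommutativeRing Π
  open Algebra.Properties.CommutativeMonoid.Sum +-commutativeMonoid using (sum)

  _≟_ : Decidable _≈_
  X ≟ Y = Fin.all? λ i → R._≟_ i (X i) (Y i)

  open InvolutoryCayleyGraph Π _≟_
  open IsAdditiveSubgroup Component₀-isAdditiveSubgroup using (∈-resp; 0∈; +-closed; -‿closed; difference-closed; ∑-closed)

  atAndOff : ∀ {p} {P : Fin t → Set p} i → P i → (∀ {k} → k ≢ i → P k) → ∀ k → P k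
  atAndOff i Pᵢ Pₖ k with k Fin.≟ i
  ... | yes ≡.refl = Pᵢ
  ... | no  k≢i    = Pₖ k≢i

  update : Carrier → (i : Fin t) → R.Carrier i → Carrier
  update X i a k with k Fin.≟ i
  ... | yes ≡.refl = a
  ... | no  _      = X k

  update-at : ∀ X i a → R._≈_ i (update X i a i) a
  update-at X i a with i Fin.≟ i
  ... | yes ≡.refl = R.refl i
  ... | no  i≢i    = contradiction ≡.refl i≢i

  update-off : ∀ X {i k} a → k ≢ i → R._≈_ k (update X i a k) (X k)
  update-off X {i} {k} a k≢i with k Fin.≟ i
  ... | yes k≡i = contradiction k≡i k≢i
  ... | no  _   = R.refl k

  δ : (i : Fin t) → R.Carrier i → Carrier
  δ = update 0#

  δ-at : ∀ i a → R._≈_ i (δ i a i) a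
  δ-at = update-at 0#

  δ-off : ∀ {i k} a → k ≢ i → R._≈_ k (δ i a k) (R.0# k)
  δ-off = update-off 0#

  δ-cong : ∀ i {a b} → R._≈_ i a b → δ i a ≈ δ i b
  δ-cong i a≈b = atAndOff i (R.trans i (δ-at i _) (R.trans i a≈b (R.sym i (δ-at i _))))
                            (λ k≢i → R.trans _ (δ-off _ k≢i) (R.sym _ (δ-off _ k≢i)))

  δ-0 : ∀ i → 0# ≈ δ i (R.0# i)
  δ-0 i = atAndOff i (R.sym i (δ-at i _)) (λ k≢i → R.sym _ (δ-off _ k≢i))

  δ-+ : ∀ i a b → δ i a + δ i b ≈ δ i (R._+_ i a b)
  δ-+ i a b = atAndOff i (R.trans i (R.+-cong i (δ-at i a) (δ-at i b)) (R.sym i (δ-at i _)))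
    (λ k≢i → R.trans _ (R.+-cong _ (δ-off a k≢i) (δ-off b k≢i)) (R.trans _ (R.+-identityʳ _ _) (R.sym _ (δ-off _ k≢i))))

  δ-‿ : ∀ i a → - δ i a ≈ δ i (R.-_ i a)
  δ-‿ i a = atAndOff i (R.trans i (R.-‿cong i (δ-at i a)) (R.sym i (δ-at i _)))
    (λ k≢i → R.trans _ (R.-‿cong _ (δ-off a k≢i)) (R.trans _ (R.-0#≈0# _) (R.sym _ (δ-off _ k≢i))))

  δ⁻¹Component₀ : (i : Fin t) → Pred (R.Carrier i) (c ⊔ ℓ)
  δ⁻¹Component₀ i a = δ i a ∈ Component₀

  δ⁻¹Component₀-isAdditiveSubgroup : ∀ i → IsAdditiveSubgroup (Rs i) (δ⁻¹Component₀ i)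
  δ⁻¹Component₀-isAdditiveSubgroup i = record
    { ∈-resp   = ∈-resp ∘ δ-cong i
    ; 0∈       = ∈-resp (δ-0 i) 0∈
    ; +-closed = λ a∈ b∈ → ∈-resp (δ-+ i _ _) (+-closed a∈ b∈)
    ; -‿closed = λ a∈ → ∈-resp (δ-‿ i _) (-‿closed a∈)
    }

  sum-pointwise : ∀ {n} (F : Vector Carrier n) k →
                  sum F k ≡ Algebra.Properties.CommutativeMonoid.Sum.sum (R.+-commutativeMonoid k) (λ l → F l k)
  sum-pointwise {zero}  F k = ≡.refl
  sum-pointwise {suc n} F k = ≡.cong (R._+_ k (F Fin.zero k)) (sum-pointwise (tail F) k)

  -- X = ∑ₖ δ k (X k)
  span : ∀ X → (∀ k → δ k (X k) ∈ Component₀) → X ∈ Component₀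
  span X δX∈ = ∈-resp ∑δX≈X (∑-closed δX∈)
    where
    ∑δX≈X : sum (λ k → δ k (X k)) ≈ X
    ∑δX≈X k = R.trans k (R.reflexive k (sum-pointwise (λ l → δ l (X l)) k))
      (R.trans k (sum-supported (R.+-monoid k) (λ l → δ l (X l) k) k (λ l l≢k → δ-off _ (l≢k ∘ ≡.sym))) (δ-at k (X k)))

  update-involution : ∀ {X} i {a} → Involution Π X → Involution (Rs i) a → Involution Π (update X i a)
  update-involution i X²≈1 a²≈1 = atAndOff i
    (R.trans i (R.*-cong i (update-at _ i _) (update-at _ i _)) a²≈1)
    (λ k≢i → R.trans _ (R.*-cong _ (update-off _ _ k≢i) (update-off _ _ k≢i)) (X²≈1 _))

  δ[u-v]∈Component₀ : ∀ i {u v} → Involution (Rs i) u → Involution (Rs i) v → R._-_ i u v ∈ δ⁻¹Component₀ i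
  δ[u-v]∈Component₀ i {u} {v} u²≈1 v²≈1 = ∈-resp difference (difference-closed (1[i↦-]∈ u²≈1) (1[i↦-]∈ v²≈1))
    where
    1[i↦-]∈ : ∀ {w} → Involution (Rs i) w → update 1# i w ∈ Component₀
    1[i↦-]∈ w²≈1 = involution∈Component₀ (update-involution i (λ k → R.*-identityʳ k _) w²≈1)
    difference : update 1# i u - update 1# i v ≈ δ i (R._-_ i u v)
    difference = atAndOff i
      (R.trans i (R.+-cong i (update-at _ i _) (R.-‿cong i (update-at _ i _))) (R.sym i (δ-at i _)))
      (λ k≢i → R.trans _ (R.+-cong _ (update-off _ _ k≢i) (R.-‿cong _ (update-off _ _ k≢i)))
                         (R.trans _ (R.-‿inverseʳ _ _) (R.sym _ (δ-off _ k≢i))))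

  projection : ΓConnected rawRing → ∀ i → ΓConnectedRing (Rs i)
  projection connected i a b =
    R.≈⇒Reachable i (R.sym i (δ-at i a)) ◅◅ gmap (λ X → X i) step (connected (δ i a) (δ i b)) ◅◅ R.≈⇒Reachable i (δ-at i b)
    where
    step : ∀ {X Y} → Step rawRing X Y → Step (R.rawRing i) (X i) (Y i)
    step (inj₂ X≈Y)                  = inj₂ (X≈Y i)
    step (inj₁ (_ , X-Y-involution)) = R.involution⇒Step i (X-Y-involution i)

  ℤOddPrimePower⇒δ∈Component₀ : ∀ i → IsZOddPrimePower (Rs i) → ∀ a → a ∈ δ⁻¹Component₀ i
  ℤOddPrimePower⇒δ∈Component₀ i (p , k , _ , 2∤p , _ , _ , iso) a =
    δ⁻¹.∈-resp (R.sym i (proj₂ a≈z*2)) (δ⁻¹.fromℤ*-closed 2∈ (proj₁ a≈z*2))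
    where
    module δ⁻¹ = IsAdditiveSubgroup (δ⁻¹Component₀-isAdditiveSubgroup i)
    a≈z*2 : ∃[ z ] R._≈_ i a (R._*_ i (R.fromℤ i z) (R.fromℕ i 2))
    a≈z*2 = ℤModIsomorphism.odd⇒multipleOf2 (Rs i) iso (¬2∣⇒¬2∣^ 2∤p k) a
    2∈ : R.fromℕ i 2 ∈ δ⁻¹Component₀ i
    2∈ = δ⁻¹.∈-resp (R.+-congˡ i (R.-‿involutive i _))
                (δ[u-v]∈Component₀ i (R.*-identityʳ i _) (R.trans i (R.-1*x≈-x i _) (R.-‿involutive i _)))

  allOdd⇒connected : (∀ i → IsZOddPrimePower (Rs i)) → ΓConnected rawRing
  allOdd⇒connected odd =
    Component₀-universal⇒connected λ X → span X λ k → ℤOddPrimePower⇒δ∈Component₀ k (odd k) (X k)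

  oneEven⇒connected : ∀ j → ΓConnectedRing (Rs j) → (∀ i → i ≢ j → IsZOddPrimePower (Rs i)) → ΓConnected rawRing
  oneEven⇒connected j connectedⱼ odd = Component₀-universal⇒connected λ X →
    span X (atAndOff j (evenComponent (X j)) λ {k} k≢j → ℤOddPrimePower⇒δ∈Component₀ k (odd k k≢j) (X k))
    where
    module δ⁻¹ = IsAdditiveSubgroup (δ⁻¹Component₀-isAdditiveSubgroup j)
    open IntegerMultiples Π using (module Solver)
    open Solver using (solve; _:=_; _:-_)
    1-δⱼ1 : Carrier
    1-δⱼ1 = 1# - δ j (R.1# j)
    1-δⱼ1∈ : 1-δⱼ1 ∈ Component₀
    1-δⱼ1∈ = span 1-δⱼ1 (atAndOff j
      (δ⁻¹.∈-resp (R.sym j (R.trans j (R.+-congˡ j (R.-‿cong j (δ-at j _))) (R.-‿inverseʳ j _))) δ⁻¹.0∈)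
      λ {k} k≢j → ℤOddPrimePower⇒δ∈Component₀ k (odd k k≢j) (1-δⱼ1 k))
    1∈ : R.1# j ∈ δ⁻¹Component₀ j
    1∈ = ∈-resp (solve 2 (λ e x → e :- (e :- x) := x) refl 1# (δ j (R.1# j)))
                (difference-closed (involution∈Component₀ (*-identityʳ 1#)) 1-δⱼ1∈)
    involution∈ : ∀ {u} → Involution (Rs j) u → u ∈ δ⁻¹Component₀ j
    involution∈ {u} u²≈1 = δ⁻¹.∈-resp [u-1]+1≈u (δ⁻¹.+-closed (δ[u-v]∈Component₀ j u²≈1 (R.*-identityʳ j _)) 1∈)
      where [u-1]+1≈u = R.trans j (R.+-assoc j _ _ _) (R.trans j (R.+-congˡ j (R.-‿inverseˡ j _)) (R.+-identityʳ j u))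
    evenComponent : ∀ a → a ∈ δ⁻¹Component₀ j
    evenComponent a = R.Component₀⊆ j (δ⁻¹Component₀-isAdditiveSubgroup j) involution∈ (connectedⱼ (R.0# j) a)

  module _ (local : ∀ i → IsLocal (Rs i)) where
    private module L (i : Fin t) = LocalRing (Rs i) (finite i) (local i)

    twoEvenComponents⇒disconnected : ∀ {i j} → i ≢ j → R.fromℕ i 2 ∈ L.M i → R.fromℕ j 2 ∈ L.M j → ¬ ΓConnected rawRing
    twoEvenComponents⇒disconnected {i} {j} i≢j 2∈Mᵢ 2∈Mⱼ connected =
      δᵢ1-unbalanced (along (connected 0# (δ i (R.1# i))) (inj₁ (L.zero∈ i , L.zero∈ j)))
      where
      parityᵢ = λ {x y} → L.2∈M⇒Step-parity i {x} {y} 2∈Mᵢ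
      parityⱼ = λ {x y} → L.2∈M⇒Step-parity j {x} {y} 2∈Mⱼ
      Balanced : Carrier → Set (c ⊔ ℓ)
      Balanced X = (X i ∈ L.M i × X j ∈ L.M j)
                 ⊎ (R._-_ i (X i) (R.1# i) ∈ L.M i × R._-_ j (X j) (R.1# j) ∈ L.M j)
      step : ∀ {X Y} → Step rawRing X Y → Balanced X → Balanced Y
      step (inj₂ X≈Y) (inj₁ (Xᵢ∈ , Xⱼ∈)) = inj₁ (L.resp i (X≈Y i) Xᵢ∈ , L.resp j (X≈Y j) Xⱼ∈)
      step (inj₂ X≈Y) (inj₂ (Xᵢ∈ , Xⱼ∈)) =
        inj₂ (L.resp i (R.+-congʳ i (X≈Y i)) Xᵢ∈ , L.resp j (R.+-congʳ j (X≈Y j)) Xⱼ∈)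
      step (inj₁ (_ , X-Y-involution)) (inj₁ (Xᵢ∈ , Xⱼ∈)) =
        inj₂ (proj₁ (parityᵢ (X-Y-involution i)) Xᵢ∈ , proj₁ (parityⱼ (X-Y-involution j)) Xⱼ∈)
      step (inj₁ (_ , X-Y-involution)) (inj₂ (Xᵢ∈ , Xⱼ∈)) =
        inj₁ (proj₂ (parityᵢ (X-Y-involution i)) Xᵢ∈ , proj₂ (parityⱼ (X-Y-involution j)) Xⱼ∈)
      along : ∀ {X Y} → Reachable rawRing X Y → Balanced X → Balanced Y
      along ε           = id
      along (s ◅ X⇝Y) = along X⇝Y ∘ step s
      δᵢ1-unbalanced : ¬ Balanced (δ i (R.1# i))
      δᵢ1-unbalanced (inj₁ (1∈Mᵢ , _)) = L.proper i (L.resp i (δ-at i _) 1∈Mᵢ)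
      δᵢ1-unbalanced (inj₂ (_ , δᵢ1ⱼ-1∈Mⱼ)) =
        L.proper j (L.resp j 0-[0-1]≈1 (L.x-y∈M j (L.zero∈ j) (L.resp j (R.+-congʳ j δᵢ1ⱼ≈0) δᵢ1ⱼ-1∈Mⱼ)))
        where
        δᵢ1ⱼ≈0 : R._≈_ j (δ i (R.1# i) j) (R.0# j)
        δᵢ1ⱼ≈0 = δ-off _ (i≢j ∘ ≡.sym)
        0-[0-1]≈1 : R._≈_ j (R._-_ j (R.0# j) (R._-_ j (R.0# j) (R.1# j))) (R.1# j)
        0-[0-1]≈1 = R.trans j (R.+-identityˡ j _) (R.trans j (R.-‿cong j (R.+-identityˡ j _)) (R.-‿involutive j _))

proposition2p3 : ∀ {c ℓ : Level} (t : ℕ) (Rs : Fin t → CommutativeRing c ℓ) →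
    1 ≤ t → (∀ i → IsFinite (Rs i)) → (∀ i → IsLocal (Rs i)) →
    ΓConnected (ΠRing t Rs) ⇔
      ((∀ i → IsZOddPrimePower (Rs i))
       ⊎ (∃[ j ] (ΓConnectedRing (Rs j) × EvenSize (Rs j) ×
                  (∀ i → i ≢ j → IsZOddPrimePower (Rs i)))))
proposition2p3 t Rs _ finite local = mk⇔ forward backward
  where
  open Product Rs finite
  module L (i : Fin t) = LocalRing (Rs i) (finite i) (local i)

  forward : ΓConnected (ΠRing t Rs) → _
  forward connected with Fin.any? (λ j → L.em j {R.fromℕ j 2 ∈ L.M j})
  ... | no  no-2∈M     = inj₁ λ i → L.2∉M⇒ℤOddPrimePower i (projection connected i) (λ 2∈Mᵢ → no-2∈M (i , 2∈Mᵢ))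
  ... | yes (j , 2∈Mⱼ) = inj₂ (j , projection connected j , L.2∈M⇒evenSize j 2∈Mⱼ , λ i i≢j →
    L.2∉M⇒ℤOddPrimePower i (projection connected i) λ 2∈Mᵢ →
      twoEvenComponents⇒disconnected local i≢j 2∈Mᵢ 2∈Mⱼ connected)

  backward : _ → ΓConnected (ΠRing t Rs)
  backward (inj₁ allOdd)                     = allOdd⇒connected allOdd
  backward (inj₂ (j , connectedⱼ , _ , odd)) = oneEven⇒connected j connectedⱼ odd
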